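{- Let $\mathcal{G}$ satisfy the standing assumptions below, and let $\sigma,\sigma'$ be nodes of $\mathcal{L}$. If $F(\sigma)\Rightarrow F(\sigma')$, then $\sigma\longrightarrow\sigma'$.
   Context: Production grammars. A production grammar is $\mathcal{G}=(V,V_i,V_t,P)$ with $V$ a finite alphabet, $V_i,V_t\subseteq V$ and $P$ a finite set of pairs $(\Gamma,\Delta)$ of strings over $V$, written $\Gamma\to\Delta$. Elements of $V_t$ are terminals, others nonterminals; a sentence is a string of terminals. A production is applicable to $\sigma$ if $\sigma=\sigma_1\Gamma\sigma_2$, with application $\sigma_1\Delta\sigma_2$; it is leftmost applicable there if for every production $\Gamma'\to\Delta'$ and every decomposition $\sigma=\gamma_1\Gamma'\gamma_2$, $|\Gamma|\le|\Gamma'|$ and $|\sigma_1|\le|\gamma_1|$. Write $\sigma\longrightarrow\sigma'$ if some production is leftmost applicable to $\sigma$ and $\sigma'$ is the result of that application. Standing assumptions: $\mathcal{G}$ is well-formed (every reduction sequence ultimately leads to a sentence); no production has an empty side; no terminal occurs on a left side; $\mathcal{G}$ is normal (both sides of every production have length 1 or 2); $V_i=\{S\}$; every production whose right side contains a terminal has as right side a single terminal. $\mathcal{L}$ is the transition graph of $\longrightarrow$ generated by $\{S\}$: its nodes are the strings reachable from $S$ by finitely many leftmost reductions, with an edge from $\sigma$ to $\sigma'$ iff $\sigma\longrightarrow\sigma'$. Production machine. Three tapes (top, middle input/output, bottom), infinite both ways, divided into squares each empty or holding one symbol; one scanned square per tape, aligned. A tape moving "left" makes the square formerly to the right of the scanned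 one become scanned; "right" is the opposite. Writing (top, middle, bottom) for the scanned contents, $\emptyset$ for empty, $(X)$ for "empty or $X$", the moves are: (1) $(C,\emptyset,(A))$: $C$ moves into the middle square, top square becomes empty. (2) $(\emptyset,B,\emptyset)$: top tape moves left, middle square emptied, $B$ written into bottom square. (3) $(C,B,(A))$: top tape moves right. (4) $(\emptyset,B,A)$, $A$ nonempty: bottom tape moves left. (5) $(\emptyset,B,(A))$ provided $(A)B\to C(D)$ is in $P$ (left side $AB$ if bottom holds $A$, $B$ if bottom empty; right side $C$ or $CD$): $C$ written in middle square, $D$ (if present) in top square, bottom tape moves right with $A$ (if any) removed. (6) $(\emptyset,D,\emptyset)$, $D\in V_t$: top and middle tapes move left. The generative machine performs at each step the first applicable move in the order 5, 6, 1, 2, 3, 4, the production in move 5 chosen nondeterministically; a state "allows" a move if that move is the one performed from it under this rule. Collapsed relation: if $s\xrightarrow{5}s'$ via production $p$ and $s'\xrightarrow{m_1}s_1\cdots\xrightarrow{m_k}s_k$ is the (unique) sequence with $m_i\neq5$ ending in a state $s_k$ allowing no move or a move 5, then $s\Rightarrow s_k$ via $p$. The map $F$. For $\sigma=t_1\cdots t_p\,n_1\cdots n_q\,P_1P_2\,m_1\cdots m_r$ with the $t_i$ terminals, the other symbols nonterminals, and the leftmost applicable production having left side $P_1P_2$ ($P_1$ possibly empty), $F(\sigma)$ is the state: top scanned square empty with $m_1,\dots,m_r$ in order immediately to its right; middle scanned square $P_2$ with $t_1,\dots,t_p$ in order immediately to its left; bottom scanned square $P_1$ (empty if $P_1$ empty)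 with $n_1,\dots,n_q$ in order immediately to its left; all else empty. If no production applies to $\sigma$, $F(\sigma)$ has $\sigma$ immediately to the left of the middle scanned square and all else empty. -}

module Defs where

open import Data.Nat using (ℕ; zero; suc; _≤_)
open import Data.Integer using (ℤ; +_; -[1+_]; _+_; _-_; 1ℤ)
open import Data.Bool using (Bool; true; false)
open import Data.Fin using (Fin)
open import Data.List using (List; []; _∷_; _++_; length; reverse; [_])
open import Data.List.Membership.Propositional using (_∈_)
open import Data.List.Relation.Unary.All using (All)
open import Data.List.Relation.Unary.Any using (Any)
open import Data.Maybe using (Maybe; just; nothing)
open import Data.Product using (Σ; ∃; _×_; _,_)
open import Data.Sum using (_⊎_)
open import Data.Empty using (⊥)
open import Relation.Nullary using (¬_)
open import Relation.Binary.PropositionalEquality using (_≡_; _≢_)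
open import Relation.Binary.Construct.Closure.ReflexiveTransitive using (Star)

-- Production grammars  G = (V, V_i, V_t, P) with V = Fin n, V_i = {S},
-- V_t given by the characteristic function isT.

record Grammar : Set where
  field
    n   : ℕ
    isT : Fin n → Bool
    S   : Fin n
    P   : List (List (Fin n) × List (Fin n))

nth : {A : Set} → List A → ℕ → Maybe A
nth []       _       = nothing
nth (x ∷ xs) zero    = just x
nth (x ∷ xs) (suc k) = nth xs k

maybeToList : {A : Set} → Maybe A → List A
maybeToList nothing  = []
maybeToList (just x) = [ x ]

module _ (G : Grammar) where
  open Grammar G

  Sym : Set
  Sym = Fin n

  Str : Set
  Str = List Sym

  Terminal : Sym → Set
  Terminal x = isT x ≡ true

  NonTerminal : Sym → Set
  NonTerminal x = isT x ≡ false

  Sentence : Str → Set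
  Sentence σ = All Terminal σ

  Applies : Str → Str → Set
  Applies σ σ' = Σ Str λ σ₁ → Σ Str λ σ₂ → Σ Str λ Γ → Σ Str λ Δ →
    ((Γ , Δ) ∈ P) × (σ ≡ σ₁ ++ Γ ++ σ₂) × (σ' ≡ σ₁ ++ Δ ++ σ₂)

  LeftmostApplicable : Str → Str → Str → Str → Str → Set
  LeftmostApplicable σ σ₁ Γ Δ σ₂ =
    ((Γ , Δ) ∈ P) × (σ ≡ σ₁ ++ Γ ++ σ₂) ×
    (∀ Γ' Δ' γ₁ γ₂ → (Γ' , Δ') ∈ P → σ ≡ γ₁ ++ Γ' ++ γ₂ →
       (length Γ ≤ length Γ') × (length σ₁ ≤ length γ₁))

  Reduce : Str → Str → Set
  Reduce σ σ' = Σ Str λ σ₁ → Σ Str λ σ₂ → Σ Str λ Γ → Σ Str λ Δ →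
    LeftmostApplicable σ σ₁ Γ Δ σ₂ × (σ' ≡ σ₁ ++ Δ ++ σ₂)

  Node : Str → Set
  Node σ = Star Reduce [ S ] σ

  -- well-formed: every reduction sequence (from S) ultimately leads to a
  -- sentence: there is no infinite reduction sequence from S, and every
  -- string reachable from S to which no production applies is a sentence.
  WellFormed : Set
  WellFormed =
    (¬ (Σ (ℕ → Str) λ f → (f zero ≡ [ S ]) × (∀ i → Applies (f i) (f (suc i))))) ×
    (∀ σ → Star Applies [ S ] σ → (∀ σ' → ¬ Applies σ σ') → Sentence σ)

  record StandingAssumptions : Set where
    field
      wellFormed     : WellFormed
      noEmptySide    : ∀ Γ Δ → (Γ , Δ) ∈ P → (Γ ≢ []) × (Δ ≢ [])
      noTerminalLeft : ∀ Γ Δ → (Γ , Δ) ∈ P → All NonTerminal Γ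
      normal         : ∀ Γ Δ → (Γ , Δ) ∈ P →
                         (1 ≤ length Γ) × (length Γ ≤ 2) × (1 ≤ length Δ) × (length Δ ≤ 2)
      terminalRight  : ∀ Γ Δ → (Γ , Δ) ∈ P → Any Terminal Δ →
                         Σ Sym λ t → Δ ≡ [ t ]

  -- The production machine.  A tape is a map from square positions to
  -- contents (nothing = empty); the scanned square is position 0.

  Tape : Set
  Tape = ℤ → Maybe Sym

  record MState : Set where
    constructor mstate
    field
      top mid bot : Tape
  open MState public

  _≈_ : MState → MState → Set
  s ≈ s' = ∀ i → (top s i ≡ top s' i) × (mid s i ≡ mid s' i) × (bot s i ≡ bot s' i)

  write : Maybe Sym → Tape → Tape
  write x t (+ zero) = x
  write x t i        = t i

  -- tape moves left: the square formerly to the right of the scanned one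
  -- becomes scanned
  moveL : Tape → Tape
  moveL t i = t (i + 1ℤ)

  moveR : Tape → Tape
  moveR t i = t (i - 1ℤ)

  emptyTape : Tape
  emptyTape _ = nothing

  Step1 : MState → MState → Set
  Step1 s s' = Σ Sym λ C → (top s (+ 0) ≡ just C) × (mid s (+ 0) ≡ nothing) ×
    (s' ≈ mstate (write nothing (top s)) (write (just C) (mid s)) (bot s))

  Step2 : MState → MState → Set
  Step2 s s' = Σ Sym λ B → (top s (+ 0) ≡ nothing) × (mid s (+ 0) ≡ just B) ×
    (bot s (+ 0) ≡ nothing) ×
    (s' ≈ mstate (moveL (top s)) (write nothing (mid s)) (write (just B) (bot s)))

  Step3 : MState → MState → Set
  Step3 s s' = Σ Sym λ C → Σ Sym λ B → (top s (+ 0) ≡ just C) × (mid s (+ 0) ≡ just B) ×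
    (s' ≈ mstate (moveR (top s)) (mid s) (bot s))

  Step4 : MState → MState → Set
  Step4 s s' = Σ Sym λ B → Σ Sym λ A → (top s (+ 0) ≡ nothing) × (mid s (+ 0) ≡ just B) ×
    (bot s (+ 0) ≡ just A) ×
    (s' ≈ mstate (top s) (mid s) (moveL (bot s)))

  Step5 : (p : Str × Str) → MState → MState → Set
  Step5 (Γ , Δ) s s' = ((Γ , Δ) ∈ P) ×
    Σ Sym λ B → Σ Sym λ C → Σ (Maybe Sym) λ mD →
    (top s (+ 0) ≡ nothing) × (mid s (+ 0) ≡ just B) ×
    (Γ ≡ maybeToList (bot s (+ 0)) ++ [ B ]) × (Δ ≡ C ∷ maybeToList mD) ×
    (s' ≈ mstate (write mD (top s)) (write (just C) (mid s)) (moveR (write nothing (bot s))))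

  Step6 : MState → MState → Set
  Step6 s s' = Σ Sym λ D → (top s (+ 0) ≡ nothing) × (mid s (+ 0) ≡ just D) ×
    Terminal D × (bot s (+ 0) ≡ nothing) ×
    (s' ≈ mstate (moveL (top s)) (moveL (mid s)) (bot s))

  App : (MState → MState → Set) → MState → Set
  App R s = Σ MState λ s' → R s s'

  App5 : MState → Set
  App5 s = Σ (Str × Str) λ p → App (Step5 p) s

  Allows6 Allows1 Allows2 Allows3 Allows4 AllowsNone : MState → Set
  Allows6 s = App Step6 s × ¬ App5 s
  Allows1 s = App Step1 s × ¬ App5 s × ¬ App Step6 s
  Allows2 s = App Step2 s × ¬ App5 s × ¬ App Step6 s × ¬ App Step1 s
  Allows3 s = App Step3 s × ¬ App5 s × ¬ App Step6 s × ¬ App Step1 s × ¬ App Step2 s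
  Allows4 s = App Step4 s × ¬ App5 s × ¬ App Step6 s × ¬ App Step1 s × ¬ App Step2 s ×
              ¬ App Step3 s
  AllowsNone s = ¬ App5 s × ¬ App Step6 s × ¬ App Step1 s × ¬ App Step2 s ×
              ¬ App Step3 s × ¬ App Step4 s

  NonFiveStep : MState → MState → Set
  NonFiveStep s s' =
    (Allows6 s × Step6 s s') ⊎ (Allows1 s × Step1 s s') ⊎ (Allows2 s × Step2 s s') ⊎
    (Allows3 s × Step3 s s') ⊎ (Allows4 s × Step4 s s')

  CollapsedVia : (p : Str × Str) → MState → MState → Set
  CollapsedVia p s t = Σ MState λ s₁ →
    Step5 p s s₁ × Star NonFiveStep s₁ t × (AllowsNone t ⊎ App5 t)

  _⇒_ : MState → MState → Set
  s ⇒ t = Σ (Str × Str) λ p → CollapsedVia p s t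

  -- The map F (as a relation  IsF σ s  meaning  s = F(σ)).

  leftOf : Str → Tape
  leftOf xs (+ _)       = nothing
  leftOf xs -[1+ j ]    = nth (reverse xs) j

  rightOf : Str → Tape
  rightOf xs (+ zero)  = nothing
  rightOf xs (+ suc j) = nth xs j
  rightOf xs -[1+ _ ]  = nothing

  FState : (ts ns : Str) (P₁ : Maybe Sym) (P₂ : Sym) (ms : Str) → MState
  FState ts ns P₁ P₂ ms =
    mstate (rightOf ms) (write (just P₂) (leftOf ts)) (write P₁ (leftOf ns))

  FStuck : Str → MState
  FStuck σ = mstate emptyTape (leftOf σ) emptyTape

  IsF : Str → MState → Set
  IsF σ s =
    (Σ Str λ ts → Σ Str λ ns → Σ (Maybe Sym) λ P₁ → Σ Sym λ P₂ → Σ Str λ ms → Σ Str λ Δ →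
       All Terminal ts × All NonTerminal ns × All NonTerminal (maybeToList P₁) ×
       NonTerminal P₂ × All NonTerminal ms ×
       LeftmostApplicable σ (ts ++ ns) (maybeToList P₁ ++ [ P₂ ]) Δ ms ×
       (s ≡ FState ts ns P₁ P₂ ms))
    ⊎
    ((∀ σ' → ¬ Applies σ σ') × (s ≡ FStuck σ))

-- Move 5 from F(σ) rewrites the left side P₁P₂ exposed by F(σ), which is the leftmost applicable
-- left side at its leftmost position, into the right side Δ of some production: a leftmost reduction
-- σ ⟶ t₁⋯tₚ n₁⋯n_q Δ m₁⋯m_r.  Read the tapes as one word (middle-tape terminals, bottom tape,
-- scanned squares, top tape).  Moves 1-4 and 6 leave this word unchanged as long as the bottom tape
-- is empty whenever the scanned middle symbol is a terminal.  That holds after move 5: if Δ is a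
-- terminal, the irreducible prefix t₁⋯tₚ n₁⋯n_q followed by a terminal is never rewritten again, so
-- by well-formedness it is a sentence and q = 0.  A state determines its word, and F(σ′) reads σ′.
{-# OPTIONS --safe #-}
module Submission where

open import Defs
open import Data.Bool using (true; false) renaming (_≟_ to _≟ᵇ_)
open import Data.Empty using (⊥-elim)
open import Data.Fin.Properties using (_≟_)
open import Data.Integer using (+_; -[1+_])
open import Data.List using (List; []; _∷_; _++_; length; reverse; [_]; head; drop)
open import Data.List.Properties
  using (++-assoc; ++-identityʳ; ∷-injectiveˡ; ∷-injectiveʳ; length-++; reverse-involutive; unfold-reverse)
open import Data.List.Membership.Propositional using (_∈_; find; lose)
open import Data.List.Relation.Binary.Infix.Heterogeneous using (Infix; MkView; toView; fromView)
open import Data.List.Relation.Binary.Infix.Heterogeneous.Properties using (infix?)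
open import Data.List.Relation.Binary.Pointwise using (Pointwise-≡⇒≡; ≡⇒Pointwise-≡)
open import Data.List.Relation.Unary.All as All using (All; []; _∷_; all?)
open import Data.List.Relation.Unary.All.Properties using (++⁺; ++⁻ˡ; ++⁻ʳ)
open import Data.List.Relation.Unary.Any as Any using (Any; here; there; any?)
open import Data.List.Relation.Unary.Any.Properties using (singleton⁻)
open import Data.Maybe using (Maybe; just; nothing)
open import Data.Nat using (ℕ; zero; suc; _+_)
open import Data.Nat.Properties using (+-comm; +-identityʳ; m+1+n≰m; ≤-trans; ≤-reflexive)
open import Data.Product using (Σ; ∃; ∃₂; _×_; _,_; proj₁; proj₂; map₂)
open import Data.Sum using (_⊎_; inj₁; inj₂) renaming (map to ⊎-map)
open import Function using (_∘_)
open import Relation.Nullary using (¬_; Dec; yes; no; contradiction)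
open import Relation.Nullary.Decidable using (map′; decidable-stable)
open import Relation.Binary.PropositionalEquality
  using (_≡_; _≢_; _≗_; refl; sym; trans; cong; cong₂; subst; module ≡-Reasoning)
open import Relation.Binary.Construct.Closure.ReflexiveTransitive as Star using (Star; ε; _◅_; _◅◅_)

module _ {X : Set} where

  infix⇒split : ∀ {Γ τ : List X} → Infix _≡_ Γ τ → ∃₂ λ σ₁ σ₂ → τ ≡ σ₁ ++ Γ ++ σ₂
  infix⇒split i with MkView σ₁ Γ≋ σ₂ ← toView i =
    σ₁ , σ₂ , cong (λ Γ′ → σ₁ ++ Γ′ ++ σ₂) (sym (Pointwise-≡⇒≡ Γ≋))

  split⇒infix : ∀ {Γ τ : List X} σ₁ σ₂ → τ ≡ σ₁ ++ Γ ++ σ₂ → Infix _≡_ Γ τ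
  split⇒infix σ₁ σ₂ refl = fromView (MkView σ₁ (≡⇒Pointwise-≡ refl) σ₂)

  prefix-avoiding : ∀ (A Γ : List X) {d β γ₂} → All (_≢ d) Γ →
                    A ++ d ∷ β ≡ Γ ++ γ₂ → ∃ λ η → A ≡ Γ ++ η
  prefix-avoiding A       []      _           _ = A , refl
  prefix-avoiding []      (g ∷ Γ) (g≢d ∷ _)   e = ⊥-elim (g≢d (sym (∷-injectiveˡ e)))
  prefix-avoiding (a ∷ A) (g ∷ Γ) (_ ∷ Γ≢d) e with refl ← ∷-injectiveˡ e =
    map₂ (cong (a ∷_)) (prefix-avoiding A Γ Γ≢d (∷-injectiveʳ e))

  split-avoiding : ∀ (A γ₁ : List X) {d β Γ γ₂} → All (_≢ d) Γ →
                   A ++ d ∷ β ≡ γ₁ ++ Γ ++ γ₂ →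
                   (∃ λ η → A ≡ γ₁ ++ Γ ++ η) ⊎ (∃ λ ξ → γ₁ ≡ A ++ d ∷ ξ)
  split-avoiding A       []       Γ≢d e = inj₁ (prefix-avoiding A _ Γ≢d e)
  split-avoiding []      (c ∷ γ₁) _   e with refl ← ∷-injectiveˡ e = inj₂ (γ₁ , refl)
  split-avoiding (a ∷ A) (c ∷ γ₁) Γ≢d e with refl ← ∷-injectiveˡ e =
    ⊎-map (map₂ (cong (a ∷_))) (map₂ (cong (a ∷_))) (split-avoiding A γ₁ Γ≢d (∷-injectiveʳ e))

  nth-injective : ∀ (xs ys : List X) → (∀ j → nth xs j ≡ nth ys j) → xs ≡ ys
  nth-injective []       []       _ = refl
  nth-injective []       (_ ∷ _)  e with () ← e 0
  nth-injective (_ ∷ _)  []       e with () ← e 0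
  nth-injective (x ∷ xs) (y ∷ ys) e with refl ← e 0 = cong (x ∷_) (nth-injective xs ys (e ∘ suc))

  nth-head : ∀ (xs : List X) → nth xs 0 ≡ head xs
  nth-head []      = refl
  nth-head (_ ∷ _) = refl

  nth-drop : ∀ (xs : List X) j → nth xs (suc j) ≡ nth (drop 1 xs) j
  nth-drop []      _ = refl
  nth-drop (_ ∷ _) _ = refl

  head-drop : ∀ (xs : List X) → maybeToList (head xs) ++ drop 1 xs ≡ xs
  head-drop []      = refl
  head-drop (_ ∷ _) = refl

  reverse-∷-++ : ∀ x (xs w : List X) → reverse (x ∷ xs) ++ w ≡ reverse xs ++ x ∷ w
  reverse-∷-++ x xs w = trans (cong (_++ w) (unfold-reverse x xs)) (++-assoc (reverse xs) [ x ] w)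

  reverse-pop : ∀ (xs w : List X) → reverse (drop 1 xs) ++ maybeToList (head xs) ++ w ≡ reverse xs ++ w
  reverse-pop []       w = refl
  reverse-pop (x ∷ xs) w = sym (reverse-∷-++ x xs w)

  reverse²-++ : ∀ (xs ys w : List X) → reverse (reverse xs) ++ reverse (reverse ys) ++ w ≡ (xs ++ ys) ++ w
  reverse²-++ xs ys w =
    trans (cong₂ (λ u v → u ++ v ++ w) (reverse-involutive xs) (reverse-involutive ys))
          (sym (++-assoc xs ys w))

module _ {X : Set} (R : X → X → Set) where

  InfiniteChain : X → Set
  InfiniteChain x = Σ (ℕ → X) λ f → (f zero ≡ x) × (∀ i → R (f i) (f (suc i)))

  ◅-chain : ∀ {x y} → R x y → InfiniteChain y → InfiniteChain x
  ◅-chain {x} r (f , refl , steps) = f′ , refl , steps′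
    where
    f′ : ℕ → X
    f′ zero    = x
    f′ (suc i) = f i
    steps′ : ∀ i → R (f′ i) (f′ (suc i))
    steps′ zero    = r
    steps′ (suc i) = steps i

  ◅◅-chain : ∀ {x y} → Star R x y → InfiniteChain y → InfiniteChain x
  ◅◅-chain ε        c = c
  ◅◅-chain (r ◅ rs) c = ◅-chain r (◅◅-chain rs c)

  progress⇒chain : (Q : X → Set) → (∀ {x} → Q x → ∃ λ y → Q y × R x y) →
                   ∀ {x} → Q x → InfiniteChain x
  progress⇒chain Q next {x} qx = proj₁ ∘ orbit , refl , λ i → proj₂ (proj₂ (next (proj₂ (orbit i))))
    where
    orbit : ℕ → Σ X Q
    orbit zero    = x , qx
    orbit (suc i) = let y , qy , _ = next (proj₂ (orbit i)) in y , qy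

module _ (G : Grammar) where
  open Grammar G

  Irreducible : Str G → Set
  Irreducible τ = ∀ τ′ → ¬ Applies G τ τ′

  nonterminal≢terminal : ∀ {x y} → NonTerminal G x → Terminal G y → x ≢ y
  nonterminal≢terminal nx ty refl = contradiction (trans (sym nx) ty) λ ()

  nonterminal-sentence⇒[] : ∀ {xs} → All (NonTerminal G) xs → Sentence G xs → xs ≡ []
  nonterminal-sentence⇒[] []       _        = refl
  nonterminal-sentence⇒[] (nx ∷ _) (tx ∷ _) = contradiction refl (nonterminal≢terminal nx tx)

  applies? : ∀ τ → Dec (∃ (Applies G τ))
  applies? τ = map′ from to (any? (λ p → infix? _≟_ (proj₁ p) τ) P)
    where
    from : Any (λ p → Infix _≡_ (proj₁ p) τ) P → ∃ (Applies G τ)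
    from occurs with (Γ , Δ) , m , i ← find occurs with σ₁ , σ₂ , e ← infix⇒split i =
      σ₁ ++ Δ ++ σ₂ , σ₁ , σ₂ , Γ , Δ , m , e , refl
    to : ∃ (Applies G τ) → Any (λ p → Infix _≡_ (proj₁ p) τ) P
    to (_ , σ₁ , σ₂ , _ , _ , m , e , _) = lose m (split⇒infix σ₁ σ₂ e)

  reduce⇒applies : ∀ {σ σ′} → Reduce G σ σ′ → Applies G σ σ′
  reduce⇒applies (σ₁ , σ₂ , Γ , Δ , (m , e , _) , e′) = σ₁ , σ₂ , Γ , Δ , m , e , e′

  module _ (SA : StandingAssumptions G) where
    open StandingAssumptions SA

    irreducible-prefix-persists : ∀ {A d β τ} → Irreducible A → Terminal G d →
                                  Applies G (A ++ d ∷ β) τ → ∃ λ β′ → τ ≡ A ++ d ∷ β′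
    irreducible-prefix-persists {A} {d} irr td (γ₁ , γ₂ , Γ , Δ , m , e , refl)
      with split-avoiding A γ₁ (All.map (λ nt → nonterminal≢terminal nt td) (noTerminalLeft Γ Δ m)) e
    ... | inj₁ (η , A≡) = ⊥-elim (irr _ (γ₁ , η , Γ , Δ , m , A≡ , refl))
    ... | inj₂ (ξ , refl) = ξ ++ Δ ++ γ₂ , ++-assoc A (d ∷ ξ) (Δ ++ γ₂)

    -- No production ever touches the prefix A d, so the reduction can neither stop (A is not a
    -- sentence) nor run forever.
    irreducible-prefix-unreachable : ∀ {A d β} → Irreducible A → ¬ Sentence G A → Terminal G d →
                                     ¬ Star (Applies G) [ S ] (A ++ d ∷ β)
    irreducible-prefix-unreachable {A} {d} irr ¬sA td path =
      proj₁ wellFormed (◅◅-chain (Applies G) path (progress⇒chain (Applies G) Q next (path , _ , refl)))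
      where
      Q : Str G → Set
      Q τ = Star (Applies G) [ S ] τ × ∃ λ β → τ ≡ A ++ d ∷ β
      next : ∀ {τ} → Q τ → ∃ λ τ′ → Q τ′ × Applies G τ τ′
      next (path , β , refl) with applies? (A ++ d ∷ β)
      ... | yes (τ′ , step) = τ′ , (path ◅◅ step ◅ ε , irreducible-prefix-persists irr td step) , step
      ... | no stuck = ⊥-elim (¬sA (++⁻ˡ A (proj₂ wellFormed _ path λ τ′ step → stuck (τ′ , step))))

    -- A left side inside A would be applicable strictly to the left of the leftmost position |A|.
    leftmost-prefix-irreducible : ∀ {σ A Γ Δ β} → LeftmostApplicable G σ A Γ Δ β → Irreducible A
    leftmost-prefix-irreducible _ _ (_ , _ , [] , Δ′ , m , _ , _) = proj₁ (noEmptySide [] Δ′ m) refl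
    leftmost-prefix-irreducible {σ} {A} {Γ} {β = β} (_ , σ≡ , leftmost) _
                                (γ₁ , η , g ∷ Γ′ , Δ′ , m , A≡ , _) =
      m+1+n≰m (length γ₁)
        (≤-trans (≤-reflexive γ₁Γ′η≡A) (proj₂ (leftmost _ Δ′ γ₁ (η ++ Γ ++ β) m σ≡′)))
      where
      open ≡-Reasoning
      γ₁Γ′η≡A : length γ₁ + suc (length (Γ′ ++ η)) ≡ length A
      γ₁Γ′η≡A = trans (sym (length-++ γ₁)) (cong length (sym A≡))
      σ≡′ : σ ≡ γ₁ ++ (g ∷ Γ′) ++ η ++ Γ ++ β
      σ≡′ = begin
        σ                                ≡⟨ σ≡ ⟩
        A ++ Γ ++ β                      ≡⟨ cong (_++ Γ ++ β) A≡ ⟩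
        (γ₁ ++ (g ∷ Γ′) ++ η) ++ Γ ++ β  ≡⟨ ++-assoc γ₁ _ _ ⟩
        γ₁ ++ ((g ∷ Γ′) ++ η) ++ Γ ++ β  ≡⟨ cong (γ₁ ++_) (++-assoc (g ∷ Γ′) η _) ⟩
        γ₁ ++ (g ∷ Γ′) ++ η ++ Γ ++ β    ∎

    leftmost-terminal-step⇒sentence-prefix : ∀ {σ A Γ Δ β} → Node G σ →
      LeftmostApplicable G σ A Γ Δ β → Any (Terminal G) Δ → Sentence G A
    leftmost-terminal-step⇒sentence-prefix {A = A} {Γ} {Δ} {β} node la@(m , σ≡ , _) tΔ
      with terminalRight Γ Δ m tΔ
    ... | t , refl = decidable-stable (all? (λ x → isT x ≟ᵇ true) A) λ ¬sA →
      irreducible-prefix-unreachable (leftmost-prefix-irreducible la) ¬sA (singleton⁻ tΔ)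
        (Star.map reduce⇒applies node ◅◅ (A , β , Γ , [ t ] , m , σ≡ , refl) ◅ ε)

    rule-tail-nonterminal : ∀ {Γ C Δ} → (Γ , C ∷ Δ) ∈ P → All (NonTerminal G) Δ
    rule-tail-nonterminal {Γ} {C} {Δ} m = All.tabulate nonterminal
      where
      nonterminal : ∀ {x} → x ∈ Δ → NonTerminal G x
      nonterminal {x} x∈Δ with isT x in tx
      ... | false = refl
      ... | true with terminalRight Γ (C ∷ Δ) m (there (Any.map (λ { refl → tx }) x∈Δ))
      ...   | _ , C∷Δ≡ = contradiction (subst (x ∈_) (∷-injectiveʳ C∷Δ≡) x∈Δ) λ ()

module Machine (G : Grammar) where

  infix 4 _≋_
  _≋_ : MState G → MState G → Set
  _≋_ = _≈_ G

  top≗ : ∀ {s s′} → s ≋ s′ → top s ≗ top s′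
  top≗ e i = proj₁ (e i)

  mid≗ : ∀ {s s′} → s ≋ s′ → mid s ≗ mid s′
  mid≗ e i = proj₁ (proj₂ (e i))

  bot≗ : ∀ {s s′} → s ≋ s′ → bot s ≗ bot s′
  bot≗ e i = proj₂ (proj₂ (e i))

  ≋-mstate : ∀ {s T M B T′ M′ B′} → s ≋ mstate T M B → T ≗ T′ → M ≗ M′ → B ≗ B′ → s ≋ mstate T′ M′ B′
  ≋-mstate e eT eM eB i = trans (top≗ e i) (eT i) , trans (mid≗ e i) (eM i) , trans (bot≗ e i) (eB i)

  moveL-pos : ∀ t k → moveL G t (+ k) ≡ t (+ suc k)
  moveL-pos t k = cong (t ∘ +_) (+-comm k 1)

  moveR-neg : ∀ t k → moveR G t -[1+ k ] ≡ t -[1+ suc k ]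
  moveR-neg t k = cong (λ j → t -[1+ suc j ]) (+-identityʳ k)

  -- l and r list the squares left and right of the scanned one, nearest first.
  tape : Str G → Maybe (Sym G) → Str G → Tape G
  tape l x r (+ zero)  = x
  tape l x r (+ suc j) = nth r j
  tape l x r -[1+ j ]  = nth l j

  tape-injective : ∀ {l x r l′ x′ r′} → tape l x r ≗ tape l′ x′ r′ → l ≡ l′ × x ≡ x′ × r ≡ r′
  tape-injective e = nth-injective _ _ (e ∘ -[1+_]) , e (+ 0) , nth-injective _ _ (e ∘ +_ ∘ suc)

  write-tape : ∀ {t l x r} y → t ≗ tape l x r → write G y t ≗ tape l y r
  write-tape y e (+ zero)  = refl
  write-tape y e (+ suc j) = e (+ suc j)
  write-tape y e -[1+ j ]  = e -[1+ j ]

  advance : ∀ {t r} → t ≗ tape [] nothing r → moveL G t ≗ tape [] (head r) (drop 1 r)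
  advance {t} {r} e (+ zero)    = trans (moveL-pos t 0) (trans (e (+ 1)) (nth-head r))
  advance {t} {r} e (+ suc j)   = trans (moveL-pos t (suc j)) (trans (e (+ suc (suc j))) (nth-drop r j))
  advance         e -[1+ zero ]  = e (+ 0)
  advance         e -[1+ suc j ] = e -[1+ j ]

  retreat : ∀ {t C r} → t ≗ tape [] (just C) r → moveR G t ≗ tape [] nothing (C ∷ r)
  retreat     e (+ zero)        = e -[1+ 0 ]
  retreat     e (+ suc zero)    = e (+ 0)
  retreat     e (+ suc (suc j)) = e (+ suc j)
  retreat {t} e -[1+ j ]        = trans (moveR-neg t j) (e -[1+ suc j ])

  push : ∀ {t l D} → t ≗ tape l (just D) [] → moveL G t ≗ tape (D ∷ l) nothing []
  push {t} e (+ zero)     = trans (moveL-pos t 0) (e (+ 1))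
  push {t} e (+ suc j)    = trans (moveL-pos t (suc j)) (e (+ suc (suc j)))
  push     e -[1+ zero ]  = e (+ 0)
  push     e -[1+ suc j ] = e -[1+ j ]

  pop : ∀ {t l} → t ≗ tape l nothing [] → moveR G t ≗ tape (drop 1 l) (head l) []
  pop {t} {l} e (+ zero)        = trans (e -[1+ 0 ]) (nth-head l)
  pop         e (+ suc zero)    = e (+ 0)
  pop         e (+ suc (suc j)) = e (+ suc j)
  pop {t} {l} e -[1+ j ]        = trans (moveR-neg t j) (trans (e -[1+ suc j ]) (nth-drop l j))

  -- The tapes of a state whose top tape is empty left of its scanned square and whose middle and
  -- bottom tapes are empty right of theirs; F(σ) and everything reached from it have this shape.
  record Config : Set where
    constructor config
    field
      midLeft botLeft   : Str G
      botSq midSq topSq : Maybe (Sym G)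
      topRight          : Str G

  toState : Config → MState G
  toState (config ts ns b m t ms) = mstate (tape [] t ms) (tape ts m []) (tape ns b [])

  word : Config → Str G
  word (config ts ns b m t ms) =
    reverse ts ++ reverse ns ++ maybeToList b ++ maybeToList m ++ maybeToList t ++ ms

  scanned-top : ∀ {s} c {x} → s ≋ toState c → top s (+ 0) ≡ x → Config.topSq c ≡ x
  scanned-top _ e h = trans (sym (top≗ e (+ 0))) h

  scanned-mid : ∀ {s} c {x} → s ≋ toState c → mid s (+ 0) ≡ x → Config.midSq c ≡ x
  scanned-mid _ e h = trans (sym (mid≗ e (+ 0))) h

  scanned-bot : ∀ {s} c {x} → s ≋ toState c → bot s (+ 0) ≡ x → Config.botSq c ≡ x
  scanned-bot _ e h = trans (sym (bot≗ e (+ 0))) h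

  config-unique : ∀ {s} c c′ → s ≋ toState c → s ≋ toState c′ → c ≡ c′
  config-unique (config _ _ _ _ _ _) (config _ _ _ _ _ _) e e′
    with refl , refl , refl ← tape-injective (λ i → trans (sym (top≗ e i)) (top≗ e′ i))
       | refl , refl , refl ← tape-injective (λ i → trans (sym (mid≗ e i)) (mid≗ e′ i))
       | refl , refl , refl ← tape-injective (λ i → trans (sym (bot≗ e i)) (bot≗ e′ i))
    = refl

  -- Move 6 appends the scanned middle symbol to the terminals on the left, which leaves
  -- the word unchanged only when the bottom tape is empty.
  Invariant : Config → Set
  Invariant (config _ ns b m t ms) =
    All (NonTerminal G) (maybeToList t ++ ms) ×
    (∀ {B} → m ≡ just B → Terminal G B → ns ≡ [] × b ≡ nothing)

  Represented : Str G → MState G → Set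
  Represented w s = Σ Config λ c → s ≋ toState c × Invariant c × word c ≡ w

  represented-word : ∀ {w s c} → Represented w s → s ≋ toState c → word c ≡ w
  represented-word (c′ , s≈c′ , _ , refl) s≈c = cong word (config-unique _ c′ s≈c s≈c′)

  move1 : ∀ c {s s′} → s ≋ toState c → Invariant c → Step1 G s s′ → Represented (word c) s′
  move1 c@(config ts ns b m t ms) s≈ (C∷ms-nt , _) (C , tC , m∅ , s′≈)
    with refl ← scanned-top c s≈ tC | refl ← scanned-mid c s≈ m∅ =
    config ts ns b (just C) nothing ms ,
    ≋-mstate s′≈ (write-tape nothing (top≗ s≈)) (write-tape (just C) (mid≗ s≈)) (bot≗ s≈) ,
    (All.tail C∷ms-nt , λ { refl tC → ⊥-elim (nonterminal≢terminal G (All.head C∷ms-nt) tC refl) }) ,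
    refl

  move2 : ∀ c {s s′} → s ≋ toState c → Invariant c → Step2 G s s′ → Represented (word c) s′
  move2 c@(config ts ns b m t ms) s≈ (ms-nt , _) (B , t∅ , mB , b∅ , s′≈)
    with refl ← scanned-top c s≈ t∅ | refl ← scanned-mid c s≈ mB | refl ← scanned-bot c s≈ b∅ =
    config ts ns (just B) nothing (head ms) (drop 1 ms) ,
    ≋-mstate s′≈ (advance (top≗ s≈)) (write-tape nothing (mid≗ s≈)) (write-tape (just B) (bot≗ s≈)) ,
    (subst (All (NonTerminal G)) (sym (head-drop ms)) ms-nt , λ ()) ,
    cong (λ w → reverse ts ++ reverse ns ++ B ∷ w) (head-drop ms)

  move3 : ∀ c {s s′} → s ≋ toState c → Invariant c → Step3 G s s′ → Represented (word c) s′
  move3 c@(config ts ns b m t ms) s≈ inv (C , B , tC , mB , s′≈)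
    with refl ← scanned-top c s≈ tC | refl ← scanned-mid c s≈ mB =
    config ts ns b (just B) nothing (C ∷ ms) ,
    ≋-mstate s′≈ (retreat (top≗ s≈)) (mid≗ s≈) (bot≗ s≈) ,
    inv ,
    refl

  move4 : ∀ c {s s′} → s ≋ toState c → Invariant c → Step4 G s s′ → Represented (word c) s′
  move4 c@(config ts ns b m t ms) s≈ (ms-nt , bottomEmpty) (B , A , t∅ , mB , bA , s′≈)
    with refl ← scanned-top c s≈ t∅ | refl ← scanned-mid c s≈ mB | refl ← scanned-bot c s≈ bA =
    config ts (A ∷ ns) nothing (just B) nothing ms ,
    ≋-mstate s′≈ (top≗ s≈) (mid≗ s≈) (push (bot≗ s≈)) ,
    (ms-nt , λ { refl tB → contradiction (proj₂ (bottomEmpty refl tB)) λ () }) ,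
    cong (reverse ts ++_) (reverse-∷-++ A ns (B ∷ ms))

  move6 : ∀ c {s s′} → s ≋ toState c → Invariant c → Step6 G s s′ → Represented (word c) s′
  move6 c@(config ts ns b m t ms) s≈ (ms-nt , bottomEmpty) (D , t∅ , mD , tD , b∅ , s′≈)
    with refl ← scanned-top c s≈ t∅ | refl ← scanned-mid c s≈ mD | refl ← scanned-bot c s≈ b∅
    with refl ← proj₁ (bottomEmpty refl tD) =
    config (D ∷ ts) [] nothing nothing (head ms) (drop 1 ms) ,
    ≋-mstate s′≈ (advance (top≗ s≈)) (push (mid≗ s≈)) (bot≗ s≈) ,
    (subst (All (NonTerminal G)) (sym (head-drop ms)) ms-nt , λ ()) ,
    trans (cong (reverse (D ∷ ts) ++_) (head-drop ms)) (reverse-∷-++ D ts ms)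

  nonFive-represented : ∀ {w s s′} → Represented w s → NonFiveStep G s s′ → Represented w s′
  nonFive-represented (c , s≈ , inv , refl) (inj₁ (_ , st))                      = move6 c s≈ inv st
  nonFive-represented (c , s≈ , inv , refl) (inj₂ (inj₁ (_ , st)))               = move1 c s≈ inv st
  nonFive-represented (c , s≈ , inv , refl) (inj₂ (inj₂ (inj₁ (_ , st))))        = move2 c s≈ inv st
  nonFive-represented (c , s≈ , inv , refl) (inj₂ (inj₂ (inj₂ (inj₁ (_ , st))))) = move3 c s≈ inv st
  nonFive-represented (c , s≈ , inv , refl) (inj₂ (inj₂ (inj₂ (inj₂ (_ , st))))) = move4 c s≈ inv st

  run-represented : ∀ {w s t} → Represented w s → Star (NonFiveStep G) s t → Represented w t
  run-represented r ε          = r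
  run-represented r (st ◅ sts) = run-represented (nonFive-represented r st) sts

  after-move5 : Config → Sym G → Maybe (Sym G) → Config
  after-move5 (config ts ns _ _ _ ms) C mD = config ts (drop 1 ns) (head ns) (just C) mD ms

  move5 : ∀ c {Γ Δ s s′} → s ≋ toState c → Step5 G (Γ , Δ) s s′ →
          Σ (Sym G) λ C → Σ (Maybe (Sym G)) λ mD →
            Γ ≡ maybeToList (Config.botSq c) ++ maybeToList (Config.midSq c) ×
            Δ ≡ C ∷ maybeToList mD × s′ ≋ toState (after-move5 c C mD)
  move5 c@(config ts ns b m t ms) s≈ (_ , B , C , mD , _ , mB , refl , refl , s′≈)
    with refl ← scanned-mid c s≈ mB =
    C , mD ,
    cong (λ x → maybeToList x ++ [ B ]) (bot≗ s≈ (+ 0)) ,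
    refl ,
    ≋-mstate s′≈ (write-tape mD (top≗ s≈)) (write-tape (just C) (mid≗ s≈))
                 (pop (write-tape nothing (bot≗ s≈)))

  word-after-move5 : ∀ c C mD → word (after-move5 c C mD) ≡
    reverse (Config.midLeft c) ++ reverse (Config.botLeft c) ++ (C ∷ maybeToList mD) ++ Config.topRight c
  word-after-move5 (config ts ns _ _ _ ms) C mD = cong (reverse ts ++_) (reverse-pop ns _)

  F-config : Str G → Str G → Maybe (Sym G) → Sym G → Str G → Config
  F-config ts ns P₁ P₂ ms = config (reverse ts) (reverse ns) P₁ (just P₂) nothing ms

  leftOf≗tape : ∀ xs → leftOf G xs ≗ tape (reverse xs) nothing []
  leftOf≗tape xs (+ zero)  = refl
  leftOf≗tape xs (+ suc _) = refl
  leftOf≗tape xs -[1+ _ ]  = refl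

  rightOf≗tape : ∀ xs → rightOf G xs ≗ tape [] nothing xs
  rightOf≗tape xs (+ zero)  = refl
  rightOf≗tape xs (+ suc _) = refl
  rightOf≗tape xs -[1+ _ ]  = refl

  emptyTape≗tape : emptyTape G ≗ tape [] nothing []
  emptyTape≗tape (+ zero)  = refl
  emptyTape≗tape (+ suc _) = refl
  emptyTape≗tape -[1+ _ ]  = refl

  FState≋F-config : ∀ ts ns P₁ P₂ ms → FState G ts ns P₁ P₂ ms ≋ toState (F-config ts ns P₁ P₂ ms)
  FState≋F-config ts ns P₁ P₂ ms i =
    rightOf≗tape ms i , write-tape (just P₂) (leftOf≗tape ts) i , write-tape P₁ (leftOf≗tape ns) i

  move5-from-F : ∀ {ts ns P₁ P₂ ms Γ Δ s′} → Step5 G (Γ , Δ) (FState G ts ns P₁ P₂ ms) s′ →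
    Σ (Sym G) λ C → Σ (Maybe (Sym G)) λ mD →
      Γ ≡ maybeToList P₁ ++ [ P₂ ] × Δ ≡ C ∷ maybeToList mD ×
      s′ ≋ toState (after-move5 (F-config ts ns P₁ P₂ ms) C mD)
  move5-from-F {ts} {ns} {P₁} {P₂} {ms} = move5 (F-config ts ns P₁ P₂ ms) (FState≋F-config ts ns P₁ P₂ ms)

  IsF⇒config : ∀ {σ s} → IsF G σ s → Σ Config λ c → s ≋ toState c × word c ≡ σ
  IsF⇒config (inj₁ (ts , ns , P₁ , P₂ , ms , _ , _ , _ , _ , _ , _ , (_ , σ≡ , _) , refl)) =
    F-config ts ns P₁ P₂ ms ,
    FState≋F-config ts ns P₁ P₂ ms ,
    trans (reverse²-++ ts ns _)
          (trans (cong ((ts ++ ns) ++_) (sym (++-assoc (maybeToList P₁) [ P₂ ] ms))) (sym σ≡))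
  IsF⇒config {σ} (inj₂ (_ , refl)) =
    config (reverse σ) [] nothing nothing nothing [] ,
    (λ i → emptyTape≗tape i , leftOf≗tape σ i , emptyTape≗tape i) ,
    trans (++-identityʳ (reverse (reverse σ))) (reverse-involutive σ)

module _ (G : Grammar) (SA : StandingAssumptions G) where
  open Machine G

  after-move5-invariant : ∀ {ts P₁ P₂ σ ns ms Γ C mD} → Node G σ →
    LeftmostApplicable G σ (ts ++ ns) Γ (C ∷ maybeToList mD) ms →
    All (NonTerminal G) ns → All (NonTerminal G) ms →
    Invariant (after-move5 (F-config ts ns P₁ P₂ ms) C mD)
  after-move5-invariant {ts} {ns = ns} {C = C} node la@(m , _) ns-nt ms-nt =
    ++⁺ (rule-tail-nonterminal G SA m) ms-nt ,
    λ { refl tC → bottom-empty (ns≡[] tC) }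
    where
    ns≡[] : Terminal G C → ns ≡ []
    ns≡[] tC = nonterminal-sentence⇒[] G ns-nt
      (++⁻ʳ ts (leftmost-terminal-step⇒sentence-prefix G SA node la (here tC)))
    bottom-empty : ns ≡ [] → drop 1 (reverse ns) ≡ [] × head (reverse ns) ≡ nothing
    bottom-empty e = cong (drop 1 ∘ reverse) e , cong (head ∘ reverse) e

mainTheorem7 : (G : Grammar) → StandingAssumptions G →
    ∀ σ σ' → Node G σ → Node G σ' →
    ∀ s s' → IsF G σ s → IsF G σ' s' → _⇒_ G s s' → Reduce G σ σ'
-- The scanned middle square of F(σ) for an irreducible σ is empty, so move 5 cannot start there.
mainTheorem7 G SA σ σ′ node _ _ _ (inj₂ (_ , refl)) _ (_ , _ , (_ , _ , _ , _ , _ , () , _) , _)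
mainTheorem7 G SA σ σ′ node _ _ s′
  (inj₁ (ts , ns , P₁ , P₂ , ms , _ , _ , ns-nt , _ , _ , ms-nt , (_ , σ≡ , leftmost) , refl))
  Fσ′ ((Γ , Δ) , s₁ , step5@(m , _) , run , _)
  with C , mD , refl , refl , s₁≈ ← Machine.move5-from-F G step5
  = ts ++ ns , ms , Γ , Δ , la , σ′≡
  where
  open Machine G
  open ≡-Reasoning
  la : LeftmostApplicable G σ (ts ++ ns) Γ Δ ms
  la = m , σ≡ , leftmost
  c₁ : Config
  c₁ = after-move5 (F-config ts ns P₁ P₂ ms) C mD
  σ′≡ : σ′ ≡ (ts ++ ns) ++ Δ ++ ms
  σ′≡ with c′ , s′≈ , w′ ← IsF⇒config Fσ′ = begin
    σ′                                                     ≡⟨ sym w′ ⟩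
    word c′                                                ≡⟨ represented-word (run-represented r₁ run) s′≈ ⟩
    word c₁                                                ≡⟨ word-after-move5 (F-config ts ns P₁ P₂ ms) C mD ⟩
    reverse (reverse ts) ++ reverse (reverse ns) ++ Δ ++ ms ≡⟨ reverse²-++ ts ns _ ⟩
    (ts ++ ns) ++ Δ ++ ms                                  ∎
    where
    r₁ : Represented (word c₁) s₁
    r₁ = c₁ , s₁≈ , after-move5-invariant G SA {ts} {P₁} {P₂} node la ns-nt ms-nt , refl
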